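{- Let $g:\mathbb{N}\to\mathbb{C}$ be the Gutman–Ivić–Matula function, i.e. the unique completely additive function (so $g(1)=0$ and $g(ab)=g(a)+g(b)$ for all $a,b\in\mathbb{N}$) such that $g(p(n))=1+g(n)$ for every $n\in\mathbb{N}$, where $p(n)$ denotes the $n$-th prime in ascending order. Then $$M_{\mathbb{P}}=\sum_{p\in\mathbb{P}}\frac{1}{4^{g(p)}}<\frac12,$$ where $\mathbb{P}$ is the set of all prime numbers.
   Context: $\mathbb{N}=\{1,2,3,\dots\}$; $p(n)$ is the $n$-th prime ($p(1)=2$, $p(2)=3$, \dots); $\mathbb{P}$ is the set of primes. The function $g$ takes nonnegative integer values and counts the number of edges of the rooted tree with Matula number $n$. -}

module Defs where

open import Data.Nat using (ℕ; zero; suc)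
open import Data.Nat.Primality using (prime?)
open import Data.List using (List; []; _∷_; filter; upTo; length; map)
open import Data.Rational using (ℚ; _*_; _+_; 0ℚ; 1ℚ; _/_)
open import Data.Integer using (+_)

quarterPow : ℕ → ℚ
quarterPow zero    = 1ℚ
quarterPow (suc k) = (+ 1 / 4) * quarterPow k

primesUpTo : ℕ → List ℕ
primesUpTo m = filter prime? (upTo (suc m))

-- π(m) = number of primes ≤ m.  A prime q is the n-th prime p(n) iff π(q) = n.
primeCount : ℕ → ℕ
primeCount m = length (primesUpTo m)

sumℚ : List ℚ → ℚ
sumℚ []       = 0ℚ
sumℚ (x ∷ xs) = x + sumℚ xs

partialM : (ℕ → ℕ) → ℕ → ℚ
partialM g N = sumℚ (map (λ q → quarterPow (g q)) (primesUpTo N))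

-- Let w(n) = 4^-g(n) and let π be the prime-counting function, so that π(p(n)) = n.  Then w is
-- completely multiplicative, w(2^a) = 4^-a, and w(q) = w(π(q))/4 for every prime q.  Write A(K),
-- O(K), Q(K) for the sums of w over 1 ≤ n ≤ K, over odd n ≤ K and over odd primes q ≤ K.  Splitting
-- off the power of 2 gives A ≤ (4/3)·O; splitting off one odd prime factor gives O ≤ 1 + Q·O; and
-- since q ↦ π(q) maps the primes q ≤ N injectively into [1, π(N)], the sum of w over any set of
-- primes ≤ N is at most A(π(N))/4.  As π(N) < N, strong induction on N shows Q(N) ≤ 3/20: then
-- O(π(N)) ≤ 20/17 and A(π(N)) ≤ 80/51, so w(2) + Q(N) ≤ 20/51, and 20/51 − 1/4 < 3/20.  The same
-- bound A(π(N))/4 ≤ 20/51 < 1/2 covers every partial sum of M_P.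
module Submission where

open import Algebra.Bundles using (CommutativeMonoid)
open import Data.Empty using (⊥-elim)
open import Data.Integer using (+_)
open import Data.List using (List; []; _∷_; _++_; [_]; map; filter; upTo; applyUpTo; cartesianProduct)
open import Data.List.Membership.Propositional using (_∈_)
open import Data.List.Membership.Propositional.Properties
  using (∈-∃++; ∈-++⁻; ∈-++⁺ˡ; ∈-++⁺ʳ; ∈-filter⁻; ∈-filter⁺; ∈-upTo⁺; ∈-upTo⁻; ∈-cartesianProduct⁺)
open import Data.List.Properties
  using (length-filter; length-applyUpTo; length-++; upTo-∷ʳ; filter-++; filter-accept; filter-reject; map-upTo)
open import Data.List.Relation.Unary.All as All using (_∷_)
open import Data.List.Relation.Unary.AllPairs using (_∷_)
open import Data.List.Relation.Unary.Any using (here; there)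
open import Data.List.Relation.Unary.Unique.Propositional using (Unique)
open import Data.List.Relation.Unary.Unique.Propositional.Properties using (filter⁺; upTo⁺)
open import Data.Nat as ℕ using (ℕ; zero; suc; NonZero; _+_; _*_; _^_; z≤n; s≤s)
import Data.Nat.Properties as ℕₚ
open import Data.Nat.Divisibility using (_∣_; divides; _∣?_; ∣-trans; ∣-refl; m∣m*n; n∣m*n)
open import Data.Nat.Induction using (<-rec)
open import Data.Nat.ListAction using (product)
open import Data.Nat.Primality using (Prime; prime?; prime[2])
open import Data.Nat.Primality.Factorisation using (factorise)
open import Data.Product using (Σ; ∃-syntax; _×_; _,_; proj₁; proj₂)
open import Data.Rational as ℚ using (ℚ; 0ℚ; 1ℚ; ½; _/_; _≤_; _<_)
import Data.Rational.Properties as ℚₚ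
open import Algebra.Properties.CommutativeSemigroup
  (CommutativeMonoid.commutativeSemigroup ℚₚ.+-0-commutativeMonoid) using (x∙yz≈y∙xz)
open import Data.Sum using (inj₁; inj₂)
open import Level using (0ℓ)
open import Relation.Binary.Definitions using (tri<; tri≈; tri>)
open import Relation.Binary.PropositionalEquality
  using (_≡_; _≢_; refl; sym; trans; cong; cong₂; subst; subst₂; module ≡-Reasoning)
open import Relation.Nullary using (¬_; yes; no)
open import Relation.Nullary.Decidable using (toWitness; _×-dec_; ¬?)
open import Relation.Unary using (Pred; Decidable)

open import Defs

private
  variable
    A B T : Set

∑ : List A → (A → ℚ) → ℚ
∑ xs F = sumℚ (map F xs)

∑-++ : (xs ys : List A) (F : A → ℚ) → ∑ (xs ++ ys) F ≡ ∑ xs F ℚ.+ ∑ ys F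
∑-++ []       ys F = sym (ℚₚ.+-identityˡ (∑ ys F))
∑-++ (x ∷ xs) ys F =
  trans (cong (F x ℚ.+_) (∑-++ xs ys F)) (sym (ℚₚ.+-assoc (F x) (∑ xs F) (∑ ys F)))

∑-*ˡ : (xs : List A) (c : ℚ) (F : A → ℚ) → ∑ xs (λ x → c ℚ.* F x) ≡ c ℚ.* ∑ xs F
∑-*ˡ []       c F = sym (ℚₚ.*-zeroʳ c)
∑-*ˡ (x ∷ xs) c F =
  trans (cong (c ℚ.* F x ℚ.+_) (∑-*ˡ xs c F)) (sym (ℚₚ.*-distribˡ-+ c (F x) (∑ xs F)))

∑-map : (xs : List A) (h : A → B) (F : B → ℚ) → ∑ (map h xs) F ≡ ∑ xs (λ x → F (h x))
∑-map []       h F = refl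
∑-map (x ∷ xs) h F = cong (F (h x) ℚ.+_) (∑-map xs h F)

∑-nonNeg : (xs : List A) (F : A → ℚ) → (∀ x → 0ℚ ≤ F x) → 0ℚ ≤ ∑ xs F
∑-nonNeg []       F F≥0 = ℚₚ.≤-refl
∑-nonNeg (x ∷ xs) F F≥0 = ℚₚ.+-mono-≤ (F≥0 x) (∑-nonNeg xs F F≥0)

∑-cartesianProduct : (xs : List A) (ys : List B) (u : A → ℚ) (v : B → ℚ)
  → ∑ (cartesianProduct xs ys) (λ (x , y) → u x ℚ.* v y) ≡ ∑ xs u ℚ.* ∑ ys v
∑-cartesianProduct []       ys u v = sym (ℚₚ.*-zeroˡ (∑ ys v))
∑-cartesianProduct (x ∷ xs) ys u v = begin
  ∑ (map (x ,_) ys ++ cartesianProduct xs ys) _  ≡⟨ ∑-++ (map (x ,_) ys) (cartesianProduct xs ys) _ ⟩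
  ∑ (map (x ,_) ys) _ ℚ.+ ∑ (cartesianProduct xs ys) _
    ≡⟨ cong₂ ℚ._+_ (trans (∑-map ys (x ,_) _) (∑-*ˡ ys (u x) v)) (∑-cartesianProduct xs ys u v) ⟩
  u x ℚ.* ∑ ys v ℚ.+ ∑ xs u ℚ.* ∑ ys v           ≡⟨ ℚₚ.*-distribʳ-+ (∑ ys v) (u x) (∑ xs u) ⟨
  (u x ℚ.+ ∑ xs u) ℚ.* ∑ ys v                    ∎
  where open ≡-Reasoning

∑-middle : (xs ys : List A) (x : A) (F : A → ℚ) →
           ∑ (xs ++ x ∷ ys) F ≡ F x ℚ.+ ∑ (xs ++ ys) F
∑-middle []       ys x F = refl
∑-middle (y ∷ xs) ys x F =
  trans (cong (F y ℚ.+_) (∑-middle xs ys x F)) (x∙yz≈y∙xz (F y) (F x) (∑ (xs ++ ys) F))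

∑-≤-∑-by-injection : (R : A → T → Set) (L : List A) (X : List T) (F : A → ℚ) (W : T → ℚ)
  → (∀ x → 0ℚ ≤ W x)
  → Unique L
  → (∀ {a a′ x} → a ∈ L → a′ ∈ L → R a x → R a′ x → a ≡ a′)
  → (∀ {a} → a ∈ L → ∃[ x ] x ∈ X × R a x × F a ≤ W x)
  → ∑ L F ≤ ∑ X W
∑-≤-∑-by-injection R [] X F W W≥0 _ _ _ = ∑-nonNeg X W W≥0
∑-≤-∑-by-injection R (a ∷ L) X F W W≥0 (a∉L ∷ L-unique) R-injective dominated
  with x , x∈X , Rax , Fa≤Wx ← dominated (here refl)
  with X₁ , X₂ , refl ← ∈-∃++ x∈X =
  ℚₚ.≤-trans (ℚₚ.+-mono-≤ Fa≤Wx rest) (ℚₚ.≤-reflexive (sym (∑-middle X₁ X₂ x W)))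
  where
  dominated′ : ∀ {a′} → a′ ∈ L → ∃[ y ] y ∈ X₁ ++ X₂ × R a′ y × F a′ ≤ W y
  dominated′ a′∈L with y , y∈X , Ra′y , le ← dominated (there a′∈L) with ∈-++⁻ X₁ y∈X
  ... | inj₁ y∈X₁         = y , ∈-++⁺ˡ y∈X₁ , Ra′y , le
  ... | inj₂ (there y∈X₂) = y , ∈-++⁺ʳ X₁ y∈X₂ , Ra′y , le
  ... | inj₂ (here refl)  =
    ⊥-elim (All.lookup a∉L a′∈L (R-injective (here refl) (there a′∈L) Rax Ra′y))

  rest : ∑ L F ≤ ∑ (X₁ ++ X₂) W
  rest = ∑-≤-∑-by-injection R L (X₁ ++ X₂) F W W≥0 L-unique
           (λ a∈ a′∈ → R-injective (there a∈) (there a′∈)) dominated′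

module _ {P : Pred ℕ 0ℓ} (P? : Decidable P) where

  filterUpTo : ℕ → List ℕ
  filterUpTo K = filter P? (upTo (suc K))

  ∈-filterUpTo⁻ : ∀ K {n} → n ∈ filterUpTo K → P n × n ℕ.≤ K
  ∈-filterUpTo⁻ K n∈ with n∈upTo , Pn ← ∈-filter⁻ P? n∈ = Pn , ℕₚ.≤-pred (∈-upTo⁻ n∈upTo)

  ∈-filterUpTo⁺ : ∀ {K n} → P n → n ℕ.≤ K → n ∈ filterUpTo K
  ∈-filterUpTo⁺ Pn n≤K = ∈-filter⁺ P? (∈-upTo⁺ (s≤s n≤K)) Pn

  filterUpTo-unique : ∀ K → Unique (filterUpTo K)
  filterUpTo-unique K = filter⁺ P? (upTo⁺ (suc K))

primesUpTo-suc : ∀ n → primesUpTo (suc n) ≡ primesUpTo n ++ filter prime? [ suc n ]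
primesUpTo-suc n =
  trans (cong (filter prime?) (sym (upTo-∷ʳ (suc n)))) (filter-++ prime? (upTo (suc n)) [ suc n ])

primeCount-suc-prime : ∀ n → Prime (suc n) → primeCount (suc n) ≡ suc (primeCount n)
primeCount-suc-prime n p rewrite primesUpTo-suc n | filter-accept prime? {xs = []} p
  | length-++ (primesUpTo n) {[ suc n ]} = ℕₚ.+-comm (primeCount n) 1

primeCount-suc-¬prime : ∀ n → ¬ Prime (suc n) → primeCount (suc n) ≡ primeCount n
primeCount-suc-¬prime n ¬p rewrite primesUpTo-suc n | filter-reject prime? {xs = []} ¬p
  | length-++ (primesUpTo n) {[]} = ℕₚ.+-identityʳ (primeCount n)

primeCount-≤-suc : ∀ n → primeCount n ℕ.≤ primeCount (suc n)
primeCount-≤-suc n with prime? (suc n)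
... | yes p = ℕₚ.≤-trans (ℕₚ.n≤1+n (primeCount n)) (ℕₚ.≤-reflexive (sym (primeCount-suc-prime n p)))
... | no ¬p = ℕₚ.≤-reflexive (sym (primeCount-suc-¬prime n ¬p))

primeCount-mono : ∀ {m n} → m ℕ.≤ n → primeCount m ℕ.≤ primeCount n
primeCount-mono {m} m≤n with k , refl ← ℕₚ.m≤n⇒∃[o]m+o≡n m≤n = go k
  where
  go : ∀ k → primeCount m ℕ.≤ primeCount (m + k)
  go zero    rewrite ℕₚ.+-identityʳ m = ℕₚ.≤-refl
  go (suc k) rewrite ℕₚ.+-suc m k = ℕₚ.≤-trans (go k) (primeCount-≤-suc (m + k))

primeCount-<-prime : ∀ {m q} → Prime q → m ℕ.< q → primeCount m ℕ.< primeCount q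
primeCount-<-prime {q = suc q} p (s≤s m≤q) rewrite primeCount-suc-prime q p =
  s≤s (primeCount-mono m≤q)

primeCount-injective : ∀ {q q′} → Prime q → Prime q′ → primeCount q ≡ primeCount q′ → q ≡ q′
primeCount-injective {q} {q′} p p′ eq with ℕₚ.<-cmp q q′
... | tri< q<q′ _ _ = ⊥-elim (ℕₚ.<-irrefl eq (primeCount-<-prime p′ q<q′))
... | tri≈ _ q≡q′ _ = q≡q′
... | tri> _ _ q>q′ = ⊥-elim (ℕₚ.<-irrefl (sym eq) (primeCount-<-prime p q>q′))

primeCount-prime-nonZero : ∀ {q} → Prime q → NonZero (primeCount q)
primeCount-prime-nonZero {suc q} p = ℕ.>-nonZero (primeCount-<-prime {0} p (s≤s z≤n))

-- Of the numbers 0, …, m + 1 only the last m can be prime.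
primeCount-suc-< : ∀ m → primeCount (suc m) ℕ.< suc m
primeCount-suc-< m = s≤s (ℕₚ.≤-trans (length-filter prime? (applyUpTo (λ x → suc (suc x)) m))
                                      (ℕₚ.≤-reflexive (length-applyUpTo _ m)))

Odd : ℕ → Set
Odd n = ¬ 2 ∣ n

odd? : Decidable Odd
odd? n = ¬? (2 ∣? n)

oddPrime? : Decidable (λ n → Prime n × Odd n)
oddPrime? n = prime? n ×-dec odd? n

odd⇒nonZero : ∀ {n} → Odd n → NonZero n
odd⇒nonZero {zero}  odd = ⊥-elim (odd (divides 0 refl))
odd⇒nonZero {suc n} odd = _

odd-divisor : ∀ {d n} → d ∣ n → Odd n → Odd d
odd-divisor d∣n odd 2∣d = odd (∣-trans 2∣d d∣n)

n<2^n : ∀ n → n ℕ.< 2 ^ n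
n<2^n zero    = s≤s z≤n
n<2^n (suc n) = ℕₚ.≤-<-trans (n<2^n n)
  (subst (2 ^ n ℕ.<_) (ℕₚ.*-comm (2 ^ n) 2) (ℕₚ.m<m*n (2 ^ n) 2 {{ℕₚ.m^n≢0 2 n}} (s≤s (s≤s z≤n))))

oddPartDecomposition : ∀ n → NonZero n → ∃[ a ] ∃[ m ] 2 ^ a * m ≡ n × Odd m
oddPartDecomposition = <-rec _ go
  where
  go : ∀ n → (∀ {k} → k ℕ.< n → NonZero k → ∃[ a ] ∃[ m ] 2 ^ a * m ≡ k × Odd m)
     → NonZero n → ∃[ a ] ∃[ m ] 2 ^ a * m ≡ n × Odd m
  go n rec n≢0 with 2 ∣? n
  ... | no 2∤n = 0 , n , ℕₚ.+-identityʳ n , 2∤n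
  ... | yes (divides q refl) = double (rec (ℕₚ.m<m*n q 2 (s≤s (s≤s z≤n))) q≢0)
    where
    instance
      q≢0 : NonZero q
      q≢0 = ℕₚ.m*n≢0⇒m≢0 q {{n≢0}}
    double : ∃[ a ] ∃[ m ] 2 ^ a * m ≡ q × Odd m → ∃[ a ] ∃[ m ] 2 ^ a * m ≡ q * 2 × Odd m
    double (a , m , refl , odd) =
      suc a , m , trans (ℕₚ.*-assoc 2 (2 ^ a) m) (ℕₚ.*-comm 2 (2 ^ a * m)) , odd

oddPrimeFactor : ∀ n → Odd n → 2 ℕ.≤ n → ∃[ p ] ∃[ m ] (Prime p × Odd p) × Odd m × p * m ≡ n
oddPrimeFactor n odd 2≤n with factorise n {{odd⇒nonZero odd}}
... | record { factors = [] ; isFactorisation = n≡1 } = ⊥-elim (ℕₚ.<-irrefl (sym n≡1) 2≤n)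
... | record { factors = p ∷ ps ; isFactorisation = n≡p*m ; factorsPrime = prime-p ∷ _ } =
  p , product ps , (prime-p , odd-divisor p∣n odd) , odd-divisor m∣n odd , sym n≡p*m
  where
  p∣n : p ∣ n
  p∣n = subst (p ∣_) (sym n≡p*m) (m∣m*n (product ps))
  m∣n : product ps ∣ n
  m∣n = subst (product ps ∣_) (sym n≡p*m) (n∣m*n p)

¼ : ℚ
¼ = + 1 / 4

*-nonNeg : ∀ {p q} → 0ℚ ≤ p → 0ℚ ≤ q → 0ℚ ≤ p ℚ.* q
*-nonNeg {p} p≥0 q≥0 = ℚₚ.≤-trans (ℚₚ.≤-reflexive (sym (ℚₚ.*-zeroʳ p)))
                                  (ℚₚ.*-monoˡ-≤-nonNeg p {{ℚ.nonNegative p≥0}} q≥0)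

quarterPow-nonNeg : ∀ k → 0ℚ ≤ quarterPow k
quarterPow-nonNeg zero    = ℚₚ.nonNegative⁻¹ 1ℚ
quarterPow-nonNeg (suc k) = *-nonNeg (ℚₚ.nonNegative⁻¹ ¼) (quarterPow-nonNeg k)

quarterPow-+ : ∀ a b → quarterPow (a + b) ≡ quarterPow a ℚ.* quarterPow b
quarterPow-+ zero    b = sym (ℚₚ.*-identityˡ (quarterPow b))
quarterPow-+ (suc a) b =
  trans (cong (¼ ℚ.*_) (quarterPow-+ a b)) (sym (ℚₚ.*-assoc ¼ (quarterPow a) (quarterPow b)))

∑-quarterPow-≤ : ∀ n → ∑ (upTo n) quarterPow ≤ + 4 / 3
∑-quarterPow-≤ zero    = ℚₚ.nonNegative⁻¹ (+ 4 / 3)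
∑-quarterPow-≤ (suc n) = begin
  ∑ (upTo (suc n)) quarterPow          ≡⟨ cong (1ℚ ℚ.+_) shift ⟩
  1ℚ ℚ.+ ¼ ℚ.* ∑ (upTo n) quarterPow   ≤⟨ ℚₚ.+-monoʳ-≤ 1ℚ (ℚₚ.*-monoˡ-≤-nonNeg ¼ (∑-quarterPow-≤ n)) ⟩
  + 4 / 3                              ∎
  where
  open ℚₚ.≤-Reasoning
  shift : ∑ (applyUpTo suc n) quarterPow ≡ ¼ ℚ.* ∑ (upTo n) quarterPow
  shift = trans (cong (λ xs → ∑ xs quarterPow) (sym (map-upTo suc n)))
                (trans (∑-map (upTo n) suc quarterPow) (∑-*ˡ (upTo n) ¼ quarterPow))

+-cancelˡ-≤ : ∀ r {p q} → r ℚ.+ p ≤ r ℚ.+ q → p ≤ q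
+-cancelˡ-≤ r {p} {q} le = subst₂ _≤_ (-r+[r+x]≡x p) (-r+[r+x]≡x q) (ℚₚ.+-monoʳ-≤ (ℚ.- r) le)
  where
  -r+[r+x]≡x : ∀ x → ℚ.- r ℚ.+ (r ℚ.+ x) ≡ x
  -r+[r+x]≡x x = trans (sym (ℚₚ.+-assoc (ℚ.- r) r x))
                       (trans (cong (ℚ._+ x) (ℚₚ.+-inverseˡ r)) (ℚₚ.+-identityˡ x))

b≤1+c*b⇒b≤20/17 : ∀ {b c} → 0ℚ ≤ b → c ≤ + 3 / 20 → b ≤ 1ℚ ℚ.+ c ℚ.* b → b ≤ + 20 / 17
b≤1+c*b⇒b≤20/17 {b} {c} b≥0 c≤ b≤ = ℚₚ.*-cancelˡ-≤-pos (+ 17 / 20) (+-cancelˡ-≤ (+ 3 / 20 ℚ.* b) (begin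
  + 3 / 20 ℚ.* b ℚ.+ + 17 / 20 ℚ.* b  ≡⟨ ℚₚ.*-distribʳ-+ b (+ 3 / 20) (+ 17 / 20) ⟨
  1ℚ ℚ.* b                            ≡⟨ ℚₚ.*-identityˡ b ⟩
  b                                   ≤⟨ b≤ ⟩
  1ℚ ℚ.+ c ℚ.* b                      ≤⟨ ℚₚ.+-monoʳ-≤ 1ℚ (ℚₚ.*-monoʳ-≤-nonNeg b {{ℚ.nonNegative b≥0}} c≤) ⟩
  1ℚ ℚ.+ + 3 / 20 ℚ.* b               ≡⟨ ℚₚ.+-comm 1ℚ (+ 3 / 20 ℚ.* b) ⟩
  + 3 / 20 ℚ.* b ℚ.+ 1ℚ               ∎))
  where open ℚₚ.≤-Reasoning

module _ (g : ℕ → ℕ) (g-1 : g 1 ≡ 0)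
         (g-* : ∀ a b → NonZero a → NonZero b → g (a * b) ≡ g a + g b)
         (g-prime : ∀ n q → NonZero n → Prime q → primeCount q ≡ n → g q ≡ suc (g n)) where

  weight : ℕ → ℚ
  weight n = quarterPow (g n)

  weight-nonNeg : ∀ n → 0ℚ ≤ weight n
  weight-nonNeg n = quarterPow-nonNeg (g n)

  weight-* : ∀ {a b} → NonZero a → NonZero b → weight (a * b) ≡ weight a ℚ.* weight b
  weight-* {a} {b} a≢0 b≢0 = trans (cong quarterPow (g-* a b a≢0 b≢0)) (quarterPow-+ (g a) (g b))

  weight-1 : weight 1 ≡ 1ℚ
  weight-1 = cong quarterPow g-1

  g-2 : g 2 ≡ 1
  g-2 = trans (g-prime 1 2 _ prime[2] refl) (cong suc g-1)

  weight-2 : weight 2 ≡ ¼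
  weight-2 = cong quarterPow g-2

  weight-2^ : ∀ a → weight (2 ^ a) ≡ quarterPow a
  weight-2^ a = cong quarterPow (g-2^ a)
    where
    g-2^ : ∀ a → g (2 ^ a) ≡ a
    g-2^ zero    = g-1
    g-2^ (suc a) = trans (g-* 2 (2 ^ a) _ (ℕₚ.m^n≢0 2 a)) (cong₂ _+_ g-2 (g-2^ a))

  weight-prime : ∀ {q} → Prime q → weight q ≡ ¼ ℚ.* weight (primeCount q)
  weight-prime {q} p = cong quarterPow (g-prime (primeCount q) q (primeCount-prime-nonZero p) p refl)

  sumNonZero sumOdd sumOddPrimes : ℕ → ℚ
  sumNonZero   K = ∑ (filterUpTo ℕₚ.nonZero? K) weight
  sumOdd       K = ∑ (filterUpTo odd? K) weight
  sumOddPrimes K = ∑ (filterUpTo oddPrime? K) weight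

  sumNonZero≤geometric*sumOdd : ∀ K → sumNonZero K ≤ ∑ (upTo (suc K)) quarterPow ℚ.* sumOdd K
  sumNonZero≤geometric*sumOdd K = ℚₚ.≤-trans
    (∑-≤-∑-by-injection R (filterUpTo ℕₚ.nonZero? K) X weight W W-nonNeg
       (filterUpTo-unique ℕₚ.nonZero? K) (λ _ _ e e′ → trans (sym e) e′) dominated)
    (ℚₚ.≤-reflexive (∑-cartesianProduct (upTo (suc K)) (filterUpTo odd? K) quarterPow weight))
    where
    X : List (ℕ × ℕ)
    X = cartesianProduct (upTo (suc K)) (filterUpTo odd? K)
    R : ℕ → ℕ × ℕ → Set
    R n (a , m) = 2 ^ a * m ≡ n
    W : ℕ × ℕ → ℚ
    W (a , m) = quarterPow a ℚ.* weight m
    W-nonNeg : ∀ x → 0ℚ ≤ W x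
    W-nonNeg (a , m) = *-nonNeg (quarterPow-nonNeg a) (weight-nonNeg m)

    dominated : ∀ {n} → n ∈ filterUpTo ℕₚ.nonZero? K → ∃[ x ] x ∈ X × R n x × weight n ≤ W x
    dominated n∈ with n≢0 , n≤K ← ∈-filterUpTo⁻ ℕₚ.nonZero? K n∈
                 with a , m , refl , odd ← oddPartDecomposition _ n≢0 =
      (a , m) , ∈-cartesianProduct⁺ (∈-upTo⁺ (s≤s a≤K)) (∈-filterUpTo⁺ odd? odd m≤K) , refl ,
      ℚₚ.≤-reflexive (trans (weight-* 2^a≢0 m≢0) (cong (ℚ._* weight m) (weight-2^ a)))
      where
      2^a≢0 = ℕₚ.m^n≢0 2 a
      m≢0 = odd⇒nonZero odd
      m≤K : m ℕ.≤ K
      m≤K = ℕₚ.≤-trans (ℕₚ.m≤n*m m (2 ^ a) {{2^a≢0}}) n≤K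
      a≤K : a ℕ.≤ K
      a≤K = ℕₚ.≤-trans (ℕₚ.<⇒≤ (n<2^n a)) (ℕₚ.≤-trans (ℕₚ.m≤m*n (2 ^ a) m {{m≢0}}) n≤K)

  sumOdd≤1+sumOddPrimes*sumOdd : ∀ K → sumOdd K ≤ 1ℚ ℚ.+ sumOddPrimes K ℚ.* sumOdd K
  sumOdd≤1+sumOddPrimes*sumOdd K = ℚₚ.≤-trans
    (∑-≤-∑-by-injection R (filterUpTo odd? K) X weight W W-nonNeg
       (filterUpTo-unique odd? K) (λ _ _ e e′ → trans (sym e) e′) dominated)
    (ℚₚ.≤-reflexive (cong₂ ℚ._+_ (trans (sym (weight-* _ _)) weight-1)
       (∑-cartesianProduct (filterUpTo oddPrime? K) (filterUpTo odd? K) weight weight)))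
    where
    X : List (ℕ × ℕ)
    X = (1 , 1) ∷ cartesianProduct (filterUpTo oddPrime? K) (filterUpTo odd? K)
    R : ℕ → ℕ × ℕ → Set
    R n (p , m) = p * m ≡ n
    W : ℕ × ℕ → ℚ
    W (p , m) = weight p ℚ.* weight m
    W-nonNeg : ∀ x → 0ℚ ≤ W x
    W-nonNeg (p , m) = *-nonNeg (weight-nonNeg p) (weight-nonNeg m)

    factor : ∀ n → Odd n → n ℕ.≤ K → ∃[ x ] x ∈ X × R n x × weight n ≤ W x
    factor 0 odd _ = ⊥-elim (odd (divides 0 refl))
    factor 1 _   _ = (1 , 1) , here refl , refl , ℚₚ.≤-reflexive (weight-* _ _)
    factor n@(suc (suc _)) odd n≤K
      with p , m , oddPrime-p , odd-m , p*m≡n ← oddPrimeFactor n odd (s≤s (s≤s z≤n)) =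
      (p , m) , there (∈-cartesianProduct⁺ (∈-filterUpTo⁺ oddPrime? oddPrime-p p≤K)
                                           (∈-filterUpTo⁺ odd? odd-m m≤K)) ,
      p*m≡n , ℚₚ.≤-reflexive (trans (cong weight (sym p*m≡n)) (weight-* p≢0 m≢0))
      where
      p≢0 = odd⇒nonZero (proj₂ oddPrime-p)
      m≢0 = odd⇒nonZero odd-m
      p≤K : p ℕ.≤ K
      p≤K = ℕₚ.≤-trans (subst (p ℕ.≤_) p*m≡n (ℕₚ.m≤m*n p m {{m≢0}})) n≤K
      m≤K : m ℕ.≤ K
      m≤K = ℕₚ.≤-trans (subst (m ℕ.≤_) p*m≡n (ℕₚ.m≤n*m m p {{p≢0}})) n≤K

    dominated : ∀ {n} → n ∈ filterUpTo odd? K → ∃[ x ] x ∈ X × R n x × weight n ≤ W x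
    dominated {n} n∈ with odd , n≤K ← ∈-filterUpTo⁻ odd? K n∈ = factor n odd n≤K

  ∑-primes≤¼*sumNonZero : ∀ N (qs : List ℕ) → Unique qs → (∀ {q} → q ∈ qs → Prime q × q ℕ.≤ N)
                        → ∑ qs weight ≤ ¼ ℚ.* sumNonZero (primeCount N)
  ∑-primes≤¼*sumNonZero N qs qs-unique qs-primes = ℚₚ.≤-trans
    (∑-≤-∑-by-injection (λ q k → primeCount q ≡ k) qs X weight (λ k → ¼ ℚ.* weight k)
       (λ k → *-nonNeg (ℚₚ.nonNegative⁻¹ ¼) (weight-nonNeg k)) qs-unique injective dominated)
    (ℚₚ.≤-reflexive (∑-*ˡ X ¼ weight))
    where
    X : List ℕ
    X = filterUpTo ℕₚ.nonZero? (primeCount N)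

    injective : ∀ {q q′ k} → q ∈ qs → q′ ∈ qs → primeCount q ≡ k → primeCount q′ ≡ k → q ≡ q′
    injective q∈ q′∈ e e′ =
      primeCount-injective (proj₁ (qs-primes q∈)) (proj₁ (qs-primes q′∈)) (trans e (sym e′))

    dominated : ∀ {q} → q ∈ qs → ∃[ k ] k ∈ X × primeCount q ≡ k × weight q ≤ ¼ ℚ.* weight k
    dominated {q} q∈ with prime-q , q≤N ← qs-primes q∈ =
      primeCount q ,
      ∈-filterUpTo⁺ ℕₚ.nonZero? (primeCount-prime-nonZero prime-q) (primeCount-mono q≤N) ,
      refl , ℚₚ.≤-reflexive (weight-prime prime-q)

  ¼+sumOddPrimes≤¼*sumNonZero : ∀ N → 2 ℕ.≤ N
                              → ¼ ℚ.+ sumOddPrimes N ≤ ¼ ℚ.* sumNonZero (primeCount N)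
  ¼+sumOddPrimes≤¼*sumNonZero N 2≤N =
    subst (_≤ ¼ ℚ.* sumNonZero (primeCount N)) (cong (ℚ._+ sumOddPrimes N) weight-2)
      (∑-primes≤¼*sumNonZero N (2 ∷ oddPrimes) (All.tabulate 2∉ ∷ filterUpTo-unique oddPrime? N) primes)
    where
    oddPrimes : List ℕ
    oddPrimes = filterUpTo oddPrime? N
    2∉ : ∀ {q} → q ∈ oddPrimes → 2 ≢ q
    2∉ q∈ refl = proj₂ (proj₁ (∈-filterUpTo⁻ oddPrime? N q∈)) ∣-refl
    primes : ∀ {q} → q ∈ 2 ∷ oddPrimes → Prime q × q ℕ.≤ N
    primes (here refl) = prime[2] , 2≤N
    primes (there q∈) with (prime-q , _) , q≤N ← ∈-filterUpTo⁻ oddPrime? N q∈ = prime-q , q≤N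

  sumNonZero≤80/51 : ∀ K → sumOddPrimes K ≤ + 3 / 20 → sumNonZero K ≤ + 80 / 51
  sumNonZero≤80/51 K Q≤ = begin
    sumNonZero K                              ≤⟨ sumNonZero≤geometric*sumOdd K ⟩
    ∑ (upTo (suc K)) quarterPow ℚ.* sumOdd K  ≤⟨ ℚₚ.*-monoʳ-≤-nonNeg (sumOdd K) {{ℚ.nonNegative O≥0}}
                                                   (∑-quarterPow-≤ (suc K)) ⟩
    + 4 / 3 ℚ.* sumOdd K                      ≤⟨ ℚₚ.*-monoˡ-≤-nonNeg (+ 4 / 3) O≤ ⟩
    + 80 / 51                                 ∎
    where
    open ℚₚ.≤-Reasoning
    O≥0 : 0ℚ ≤ sumOdd K
    O≥0 = ∑-nonNeg (filterUpTo odd? K) weight weight-nonNeg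
    O≤ : sumOdd K ≤ + 20 / 17
    O≤ = b≤1+c*b⇒b≤20/17 O≥0 Q≤ (sumOdd≤1+sumOddPrimes*sumOdd K)

  sumOddPrimes≤3/20 : ∀ N → sumOddPrimes N ≤ + 3 / 20
  sumOddPrimes≤3/20 = <-rec _ go
    where
    go : ∀ N → (∀ {M} → M ℕ.< N → sumOddPrimes M ≤ + 3 / 20) → sumOddPrimes N ≤ + 3 / 20
    go 0 _ = ℚₚ.nonNegative⁻¹ (+ 3 / 20)
    go 1 _ = ℚₚ.nonNegative⁻¹ (+ 3 / 20)
    go N@(suc (suc M)) rec = +-cancelˡ-≤ ¼ (begin
      ¼ ℚ.+ sumOddPrimes N             ≤⟨ ¼+sumOddPrimes≤¼*sumNonZero N (s≤s (s≤s z≤n)) ⟩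
      ¼ ℚ.* sumNonZero (primeCount N)  ≤⟨ ℚₚ.*-monoˡ-≤-nonNeg ¼ A≤ ⟩
      ¼ ℚ.* (+ 80 / 51)                ≤⟨ toWitness {a? = ¼ ℚ.* (+ 80 / 51) ℚₚ.≤? ¼ ℚ.+ + 3 / 20} _ ⟩
      ¼ ℚ.+ + 3 / 20                   ∎)
      where
      open ℚₚ.≤-Reasoning
      A≤ : sumNonZero (primeCount N) ≤ + 80 / 51
      A≤ = sumNonZero≤80/51 (primeCount N) (rec (primeCount-suc-< (suc M)))

  partialM≤20/51 : ∀ N → partialM g N ≤ + 20 / 51
  partialM≤20/51 N = begin
    partialM g N                     ≤⟨ ∑-primes≤¼*sumNonZero N (primesUpTo N)
                                          (filterUpTo-unique prime? N) (∈-filterUpTo⁻ prime? N) ⟩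
    ¼ ℚ.* sumNonZero (primeCount N)  ≤⟨ ℚₚ.*-monoˡ-≤-nonNeg ¼ (sumNonZero≤80/51 (primeCount N)
                                          (sumOddPrimes≤3/20 (primeCount N))) ⟩
    + 20 / 51                        ∎
    where open ℚₚ.≤-Reasoning

mainTheorem1 : (g : ℕ → ℕ)
    → g 1 ≡ 0
    → (∀ a b → NonZero a → NonZero b → g (a * b) ≡ g a + g b)
    → (∀ n q → NonZero n → Prime q → primeCount q ≡ n → g q ≡ suc (g n))
    → Σ ℚ (λ s → (s < ½) × (∀ N → partialM g N ≤ s))
mainTheorem1 g g-1 g-* g-prime =
  + 20 / 51 , toWitness {a? = + 20 / 51 ℚₚ.<? ½} _ , partialM≤20/51 g g-1 g-* g-prime
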